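{- Let $B$ be a formula over $\Sigma_{\mathrm{PA}^\omega}$ with free variables among $x^\iota,y^\sigma,z^\sigma,\vec w$, write $B^r[t,u,v]$ for $B^r[t/x,u/y,v/z]$, and set $A[t,u,v]:\equiv\mathrm{Rel}(v)\wedge\mathrm{Rel}(u)\wedge B^r[t,u,v]$. Then the formula $$\Big(\forall^rx\,\forall^ry\big(\forall z\,\neg A[x,y,z]\Rightarrow\forall x'\,A[x',y,y]\big)\Rightarrow\forall h\,\neg\forall^rx\,A[x,h\,x,h(S\,x)]\Rightarrow\bot\Big)\Rightarrow\Big(\forall^rx\,\forall^ry\,\exists^rz\,B^r[x,y,z]\Rightarrow\forall^rh\,\neg\forall^rx\,B^r[x,h\,x,h(S\,x)]\Rightarrow\bot\Big)$$ (with $x,x'$ of sort $\iota$, $y,z$ of sort $\sigma$, $h$ of sort $\iota\to\sigma$, implications associating to the right) is provable, without axioms, in the sequent calculus below.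
   Context: Logic: sorts $\sigma::=\iota\mid\sigma\to\tau$; formulas $P(\vec t)\mid\bot\mid A\Rightarrow B\mid A\wedge B\mid\forall xA$; $\neg A:=A\Rightarrow\bot$; predicates are negative or positive; negative formulas $N::=P(\vec t)$ ($P$ negative) $\mid\bot\mid A\Rightarrow N\mid N\wedge N'\mid\forall xN$. Sequents $\Gamma\vdash A\mid\Delta$ with every formula of $\Delta$ negative are derived by: identity $\Gamma,A\vdash A\mid\Delta$; intro/elim rules for $\Rightarrow$, $\wedge$, $\forall$ (with the usual eigenvariable condition); from $\Gamma\vdash N\mid\Delta,N$ infer $\Gamma\vdash\bot\mid\Delta,N$; from $\Gamma\vdash\bot\mid\Delta,N$ infer $\Gamma\vdash N\mid\Delta$. $\Sigma_{\mathrm{PA}^\omega}$: one base sort $\iota$, constants $s,k,0,S,\mathrm{rec}$, and as only predicates negative inequalities $\neq_\sigma$. The extended signature adds a positive predicate $\mathrm{Rel}$ on $\iota$, with $\mathrm{Rel}(t^{\sigma\to\tau}):=\forall x^\sigma(\mathrm{Rel}(x)\Rightarrow\mathrm{Rel}(t\,x))$, $\forall^rxA:=\forall x(\mathrm{Rel}(x)\Rightarrow A)$, $\exists^rxA:=\neg\forall^rx\neg A$. Relativization: $P(\vec t)^r=P(\vec t)$, $\bot^r=\bot$, commutes with $\Rightarrow$ and $\wedge$, $(\forall xA)^r=\forall^rxA^r$. -}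

module Defs where

open import Data.List using (List; []; _∷_; map)
open import Data.List.Membership.Propositional using (_∈_)

infixr 7 _⟶_
data Sort : Set where
  ι   : Sort
  _⟶_ : Sort → Sort → Sort

Ctx : Set
Ctx = List Sort

-- typed de Bruijn variables (innermost binder = here)
infix 4 _∋_
data _∋_ : Ctx → Sort → Set where
  here  : ∀ {Γ σ} → (σ ∷ Γ) ∋ σ
  there : ∀ {Γ σ τ} → Γ ∋ τ → (σ ∷ Γ) ∋ τ

data Const : Sort → Set where
  cs   : ∀ ρ σ τ → Const ((ρ ⟶ σ ⟶ τ) ⟶ (ρ ⟶ σ) ⟶ ρ ⟶ τ)
  ck   : ∀ σ τ → Const (σ ⟶ τ ⟶ σ)
  c0   : Const ι
  cSuc : Const (ι ⟶ ι)
  crec : ∀ σ → Const (σ ⟶ (ι ⟶ σ ⟶ σ) ⟶ ι ⟶ σ)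

data Term (Γ : Ctx) : Sort → Set where
  var : ∀ {σ} → Γ ∋ σ → Term Γ σ
  con : ∀ {σ} → Const σ → Term Γ σ
  app : ∀ {σ τ} → Term Γ (σ ⟶ τ) → Term Γ σ → Term Γ τ

-- Formulas over the extended signature: negative predicates ≠_σ,
-- positive predicate Rel on ι.

infixr 5 _⇒_
infixr 6 _∧_
data Formula (Γ : Ctx) : Set where
  neq : ∀ σ → Term Γ σ → Term Γ σ → Formula Γ
  rel : Term Γ ι → Formula Γ
  ⊥ᶠ  : Formula Γ
  _⇒_ : Formula Γ → Formula Γ → Formula Γ
  _∧_ : Formula Γ → Formula Γ → Formula Γ
  all : ∀ σ → Formula (σ ∷ Γ) → Formula Γ

¬ᶠ : ∀ {Γ} → Formula Γ → Formula Γ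
¬ᶠ A = A ⇒ ⊥ᶠ

data PAω {Γ : Ctx} : Formula Γ → Set where
  neq : ∀ σ t u → PAω (neq σ t u)
  ⊥ᶠ  : PAω ⊥ᶠ
  _⇒_ : ∀ {A B} → PAω A → PAω B → PAω (A ⇒ B)
  _∧_ : ∀ {A B} → PAω A → PAω B → PAω (A ∧ B)
  all : ∀ σ {A} → PAω A → PAω (all σ A)

data Negative {Γ : Ctx} : Formula Γ → Set where
  neq : ∀ σ t u → Negative (neq σ t u)
  ⊥ᶠ  : Negative ⊥ᶠ
  _⇒_ : ∀ A {N} → Negative N → Negative (A ⇒ N)
  _∧_ : ∀ {N N'} → Negative N → Negative N' → Negative (N ∧ N')
  all : ∀ σ {N} → Negative N → Negative (all σ N)

Ren : Ctx → Ctx → Set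
Ren Γ Δ = ∀ {τ} → Γ ∋ τ → Δ ∋ τ

extR : ∀ {Γ Δ σ} → Ren Γ Δ → Ren (σ ∷ Γ) (σ ∷ Δ)
extR ρ here      = here
extR ρ (there i) = there (ρ i)

renT : ∀ {Γ Δ σ} → Ren Γ Δ → Term Γ σ → Term Δ σ
renT ρ (var i)   = var (ρ i)
renT ρ (con c)   = con c
renT ρ (app t u) = app (renT ρ t) (renT ρ u)

renF : ∀ {Γ Δ} → Ren Γ Δ → Formula Γ → Formula Δ
renF ρ (neq σ t u) = neq σ (renT ρ t) (renT ρ u)
renF ρ (rel t)     = rel (renT ρ t)
renF ρ ⊥ᶠ          = ⊥ᶠ
renF ρ (A ⇒ B)     = renF ρ A ⇒ renF ρ B
renF ρ (A ∧ B)     = renF ρ A ∧ renF ρ B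
renF ρ (all σ A)   = all σ (renF (extR ρ) A)

wkT : ∀ {Γ σ τ} → Term Γ τ → Term (σ ∷ Γ) τ
wkT = renT there

wkF : ∀ {Γ σ} → Formula Γ → Formula (σ ∷ Γ)
wkF = renF there

Sub : Ctx → Ctx → Set
Sub Γ Δ = ∀ {τ} → Γ ∋ τ → Term Δ τ

extS : ∀ {Γ Δ σ} → Sub Γ Δ → Sub (σ ∷ Γ) (σ ∷ Δ)
extS s here      = var here
extS s (there i) = wkT (s i)

subT : ∀ {Γ Δ σ} → Sub Γ Δ → Term Γ σ → Term Δ σ
subT s (var i)   = s i
subT s (con c)   = con c
subT s (app t u) = app (subT s t) (subT s u)

subF : ∀ {Γ Δ} → Sub Γ Δ → Formula Γ → Formula Δ
subF s (neq σ t u) = neq σ (subT s t) (subT s u)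
subF s (rel t)     = rel (subT s t)
subF s ⊥ᶠ          = ⊥ᶠ
subF s (A ⇒ B)     = subF s A ⇒ subF s B
subF s (A ∧ B)     = subF s A ∧ subF s B
subF s (all σ A)   = all σ (subF (extS s) A)

sub1 : ∀ {Γ σ} → Term Γ σ → Sub (σ ∷ Γ) Γ
sub1 t here      = t
sub1 t (there i) = var i

_[_] : ∀ {Γ σ} → Formula (σ ∷ Γ) → Term Γ σ → Formula Γ
A [ t ] = subF (sub1 t) A

RelS : ∀ {Γ} σ → Term Γ σ → Formula Γ
RelS ι       t = rel t
RelS (σ ⟶ τ) t = all σ (RelS σ (var here) ⇒ RelS τ (app (wkT t) (var here)))

allʳ : ∀ {Γ} σ → Formula (σ ∷ Γ) → Formula Γ
allʳ σ A = all σ (RelS σ (var here) ⇒ A)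

exʳ : ∀ {Γ} σ → Formula (σ ∷ Γ) → Formula Γ
exʳ σ A = ¬ᶠ (allʳ σ (¬ᶠ A))

_ʳ : ∀ {Γ} → Formula Γ → Formula Γ
neq σ t u ʳ = neq σ t u
rel t ʳ     = rel t
⊥ᶠ ʳ        = ⊥ᶠ
(A ⇒ B) ʳ   = (A ʳ) ⇒ (B ʳ)
(A ∧ B) ʳ   = (A ʳ) ∧ (B ʳ)
all σ A ʳ   = allʳ σ (A ʳ)

-- The sequent calculus  Γ ⊢ A | Δ  (formulas in variable context Θ).
-- Eigenvariable condition is handled by de Bruijn weakening.

data Deriv : (Θ : Ctx) → List (Formula Θ) → Formula Θ → List (Formula Θ) → Set where
  ax   : ∀ {Θ Γ Δ A} → A ∈ Γ → Deriv Θ Γ A Δ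
  ⇒I   : ∀ {Θ Γ Δ A B} → Deriv Θ (A ∷ Γ) B Δ → Deriv Θ Γ (A ⇒ B) Δ
  ⇒E   : ∀ {Θ Γ Δ A B} → Deriv Θ Γ (A ⇒ B) Δ → Deriv Θ Γ A Δ → Deriv Θ Γ B Δ
  ∧I   : ∀ {Θ Γ Δ A B} → Deriv Θ Γ A Δ → Deriv Θ Γ B Δ → Deriv Θ Γ (A ∧ B) Δ
  ∧E₁  : ∀ {Θ Γ Δ A B} → Deriv Θ Γ (A ∧ B) Δ → Deriv Θ Γ A Δ
  ∧E₂  : ∀ {Θ Γ Δ A B} → Deriv Θ Γ (A ∧ B) Δ → Deriv Θ Γ B Δ
  ∀I   : ∀ {Θ Γ Δ σ A} → Deriv (σ ∷ Θ) (map wkF Γ) A (map wkF Δ)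
       → Deriv Θ Γ (all σ A) Δ
  ∀E   : ∀ {Θ Γ Δ σ A} → Deriv Θ Γ (all σ A) Δ → (t : Term Θ σ)
       → Deriv Θ Γ (A [ t ]) Δ
  save : ∀ {Θ Γ Δ N} → Negative N → N ∈ Δ → Deriv Θ Γ N Δ → Deriv Θ Γ ⊥ᶠ Δ
  restore : ∀ {Θ Γ Δ N} → Negative N → Deriv Θ Γ ⊥ᶠ (N ∷ Δ) → Deriv Θ Γ N Δ

infix 3 _⊢_∣_
_⊢_∣_ : ∀ {Θ} → List (Formula Θ) → Formula Θ → List (Formula Θ) → Set
_⊢_∣_ {Θ} = Deriv Θ

-- Instantiating B (free variables: z = 0, y = 1, x = 2, then w⃗ = Θ)
-- inside Ξ additional bound variables.

open import Data.List using (_++_)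

wkΘ : ∀ Ξ {Θ} → Ren Θ (Ξ ++ Θ)
wkΘ []      i = i
wkΘ (_ ∷ Ξ) i = there (wkΘ Ξ i)

inst : ∀ {σ Θ} Ξ → Formula (σ ∷ σ ∷ ι ∷ Θ)
     → Term (Ξ ++ Θ) ι → Term (Ξ ++ Θ) σ → Term (Ξ ++ Θ) σ → Formula (Ξ ++ Θ)
inst {σ} {Θ} Ξ B t u v = subF s B
  where
  s : Sub (σ ∷ σ ∷ ι ∷ Θ) (Ξ ++ Θ)
  s here                      = v
  s (there here)              = u
  s (there (there here))      = t
  s (there (there (there i))) = var (wkΘ Ξ i)

instA : ∀ {σ Θ} Ξ → Formula (σ ∷ σ ∷ ι ∷ Θ)
      → Term (Ξ ++ Θ) ι → Term (Ξ ++ Θ) σ → Term (Ξ ++ Θ) σ → Formula (Ξ ++ Θ)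
instA {σ} Ξ B t u v = RelS σ v ∧ (RelS σ u ∧ inst Ξ (B ʳ) t u v)

v0 : ∀ {Γ σ} → Term (σ ∷ Γ) σ
v0 = var here
v1 : ∀ {Γ σ τ} → Term (τ ∷ σ ∷ Γ) σ
v1 = var (there here)
v2 : ∀ {Γ σ τ ρ} → Term (ρ ∷ τ ∷ σ ∷ Γ) σ
v2 = var (there (there here))

Suc : ∀ {Γ} → Term Γ ι → Term Γ ι
Suc t = app (con cSuc) t

Thm13 : ∀ σ {Θ} → Formula (σ ∷ σ ∷ ι ∷ Θ) → Formula Θ
Thm13 σ B = (P1 ⇒ P2 ⇒ ⊥ᶠ) ⇒ (Q1 ⇒ Q2 ⇒ ⊥ᶠ)
  where
  P1 = allʳ ι (allʳ σ (all σ (¬ᶠ (instA (σ ∷ σ ∷ ι ∷ []) B v2 v1 v0))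
                       ⇒ all ι (instA (ι ∷ σ ∷ ι ∷ []) B v0 v1 v1)))
  P2 = all (ι ⟶ σ) (¬ᶠ (allʳ ι (instA (ι ∷ (ι ⟶ σ) ∷ []) B v0 (app v1 v0) (app v1 (Suc v0)))))
  Q1 = allʳ ι (allʳ σ (exʳ σ (inst (σ ∷ σ ∷ ι ∷ []) (B ʳ) v2 v1 v0)))
  Q2 = allʳ (ι ⟶ σ) (¬ᶠ (allʳ ι (inst (ι ∷ (ι ⟶ σ) ∷ []) (B ʳ) v0 (app v1 v0) (app v1 (Suc v0)))))

-- It suffices to derive the two premises of the hypothesis about A from the two premises
-- about B. If h is a path for A, i.e. A[x, h x, h (S x)] for every relevant x, then the
-- conjuncts Rel(h x) make h relevant and the conjuncts B^r make it a path for B, which the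
-- second premise about B refutes. If x, y are relevant and no z satisfies A[x, y, z], the
-- first premise about B yields a relevant z with B^r[x, y, z], hence A[x, y, z]: a
-- contradiction, from which ∀x' B^r[x', y, y] follows because B^r is negative, and
-- ∀x' A[x', y, y] is that together with Rel y.
module Submission where

open import Defs
open import Data.List using (List; []; _∷_; map)
open import Data.List.Relation.Unary.Any using (here; there)
open import Data.List.Relation.Binary.Subset.Propositional using (_⊆_)
open import Data.List.Relation.Binary.Subset.Propositional.Properties using (map⁺; ∷⁺ʳ)
open import Relation.Binary.PropositionalEquality hiding ([_])

infix 4 _≗ˢ_
_≗ˢ_ : ∀ {Γ Δ} → Sub Γ Δ → Sub Γ Δ → Set
_≗ˢ_ {Γ} s s′ = ∀ {τ} (i : Γ ∋ τ) → s i ≡ s′ i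

renT-renT : ∀ {Γ Δ E σ} (ρ : Ren Δ E) (ρ′ : Ren Γ Δ) (t : Term Γ σ)
          → renT ρ (renT ρ′ t) ≡ renT (λ i → ρ (ρ′ i)) t
renT-renT ρ ρ′ (var i)   = refl
renT-renT ρ ρ′ (con c)   = refl
renT-renT ρ ρ′ (app t u) = cong₂ app (renT-renT ρ ρ′ t) (renT-renT ρ ρ′ u)

subT-cong : ∀ {Γ Δ σ} {s s′ : Sub Γ Δ} → s ≗ˢ s′ → (t : Term Γ σ) → subT s t ≡ subT s′ t
subT-cong p (var i)   = p i
subT-cong p (con c)   = refl
subT-cong p (app t u) = cong₂ app (subT-cong p t) (subT-cong p u)

subT-var : ∀ {Γ σ} {s : Sub Γ Γ} → s ≗ˢ var → (t : Term Γ σ) → subT s t ≡ t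
subT-var p (var i)   = p i
subT-var p (con c)   = refl
subT-var p (app t u) = cong₂ app (subT-var p t) (subT-var p u)

subT-renT : ∀ {Γ Δ E σ} (s : Sub Δ E) (ρ : Ren Γ Δ) (t : Term Γ σ)
          → subT s (renT ρ t) ≡ subT (λ i → s (ρ i)) t
subT-renT s ρ (var i)   = refl
subT-renT s ρ (con c)   = refl
subT-renT s ρ (app t u) = cong₂ app (subT-renT s ρ t) (subT-renT s ρ u)

renT-as-subT : ∀ {Γ Δ σ} (ρ : Ren Γ Δ) (t : Term Γ σ) → renT ρ t ≡ subT (λ i → var (ρ i)) t
renT-as-subT ρ (var i)   = refl
renT-as-subT ρ (con c)   = refl
renT-as-subT ρ (app t u) = cong₂ app (renT-as-subT ρ t) (renT-as-subT ρ u)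

extS-cong : ∀ {Γ Δ σ} {s s′ : Sub Γ Δ} → s ≗ˢ s′ → extS {σ = σ} s ≗ˢ extS s′
extS-cong p here      = refl
extS-cong p (there i) = cong wkT (p i)

extS-var : ∀ {Γ σ} {s : Sub Γ Γ} → s ≗ˢ var → extS {σ = σ} s ≗ˢ var
extS-var p here      = refl
extS-var p (there i) = cong wkT (p i)

subF-cong : ∀ {Γ Δ} {s s′ : Sub Γ Δ} → s ≗ˢ s′ → (A : Formula Γ) → subF s A ≡ subF s′ A
subF-cong p (neq σ t u) = cong₂ (neq σ) (subT-cong p t) (subT-cong p u)
subF-cong p (rel t)     = cong rel (subT-cong p t)
subF-cong p ⊥ᶠ          = refl
subF-cong p (A ⇒ B)     = cong₂ _⇒_ (subF-cong p A) (subF-cong p B)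
subF-cong p (A ∧ B)     = cong₂ _∧_ (subF-cong p A) (subF-cong p B)
subF-cong p (all σ A)   = cong (all σ) (subF-cong (extS-cong p) A)

subF-var : ∀ {Γ} {s : Sub Γ Γ} → s ≗ˢ var → (A : Formula Γ) → subF s A ≡ A
subF-var p (neq σ t u) = cong₂ (neq σ) (subT-var p t) (subT-var p u)
subF-var p (rel t)     = cong rel (subT-var p t)
subF-var p ⊥ᶠ          = refl
subF-var p (A ⇒ B)     = cong₂ _⇒_ (subF-var p A) (subF-var p B)
subF-var p (A ∧ B)     = cong₂ _∧_ (subF-var p A) (subF-var p B)
subF-var p (all σ A)   = cong (all σ) (subF-var (extS-var p) A)

subF-renF : ∀ {Γ Δ E} (s : Sub Δ E) (ρ : Ren Γ Δ) (A : Formula Γ)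
          → subF s (renF ρ A) ≡ subF (λ i → s (ρ i)) A
subF-renF s ρ (neq σ t u) = cong₂ (neq σ) (subT-renT s ρ t) (subT-renT s ρ u)
subF-renF s ρ (rel t)     = cong rel (subT-renT s ρ t)
subF-renF s ρ ⊥ᶠ          = refl
subF-renF s ρ (A ⇒ B)     = cong₂ _⇒_ (subF-renF s ρ A) (subF-renF s ρ B)
subF-renF s ρ (A ∧ B)     = cong₂ _∧_ (subF-renF s ρ A) (subF-renF s ρ B)
subF-renF s ρ (all σ A)   = cong (all σ) (trans (subF-renF (extS s) (extR ρ) A) (subF-cong p A))
  where
  p : (λ i → extS s (extR ρ i)) ≗ˢ extS (λ i → s (ρ i))
  p here      = refl
  p (there i) = refl

renF-as-subF : ∀ {Γ Δ} (ρ : Ren Γ Δ) (A : Formula Γ) → renF ρ A ≡ subF (λ i → var (ρ i)) A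
renF-as-subF ρ (neq σ t u) = cong₂ (neq σ) (renT-as-subT ρ t) (renT-as-subT ρ u)
renF-as-subF ρ (rel t)     = cong rel (renT-as-subT ρ t)
renF-as-subF ρ ⊥ᶠ          = refl
renF-as-subF ρ (A ⇒ B)     = cong₂ _⇒_ (renF-as-subF ρ A) (renF-as-subF ρ B)
renF-as-subF ρ (A ∧ B)     = cong₂ _∧_ (renF-as-subF ρ A) (renF-as-subF ρ B)
renF-as-subF ρ (all σ A)   = cong (all σ) (trans (renF-as-subF (extR ρ) A) (subF-cong p A))
  where
  p : (λ i → var (extR ρ i)) ≗ˢ extS (λ i → var (ρ i))
  p here      = refl
  p (there i) = refl

renF-RelS : ∀ {Γ Δ} σ (ρ : Ren Γ Δ) (t : Term Γ σ) → renF ρ (RelS σ t) ≡ RelS σ (renT ρ t)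
renF-RelS ι       ρ t = refl
renF-RelS (σ ⟶ τ) ρ t =
  cong (all σ) (cong₂ _⇒_ (renF-RelS σ (extR ρ) (var here))
                          (trans (renF-RelS τ (extR ρ) (app (wkT t) (var here)))
                                 (cong (λ u → RelS τ (app u (var here))) wk-commutes)))
  where
  wk-commutes : renT (extR ρ) (wkT t) ≡ wkT (renT ρ t)
  wk-commutes = trans (renT-renT (extR ρ) there t) (sym (renT-renT there ρ t))

wkF-RelS-here : ∀ {Γ σ τ} → wkF {σ = τ} (RelS σ (var {Γ = σ ∷ Γ} here)) ≡ RelS σ (var (there here))
wkF-RelS-here {σ = σ} = renF-RelS σ there (var here)

wkF-all-[here] : ∀ {Γ σ} (A : Formula (σ ∷ Γ)) → renF (extR there) A [ var here ] ≡ A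
wkF-all-[here] A = trans (subF-renF (sub1 (var here)) (extR there) A) (subF-var p A)
  where
  p : (λ i → sub1 (var here) (extR there i)) ≗ˢ var
  p here      = refl
  p (there i) = refl

wkF²-all-[there-here] : ∀ {Γ σ τ} (A : Formula (σ ∷ Γ))
  → renF (extR (there {σ = τ})) (renF (extR there) A) [ var (there here) ] ≡ wkF A
wkF²-all-[there-here] A =
  begin
    renF (extR there) (renF (extR there) A) [ var (there here) ]
  ≡⟨ subF-renF (sub1 (var (there here))) (extR there) (renF (extR there) A) ⟩
    subF (λ i → sub1 (var (there here)) (extR there i)) (renF (extR there) A)
  ≡⟨ subF-renF _ (extR there) A ⟩
    subF (λ i → sub1 (var (there here)) (extR there (extR there i))) A
  ≡⟨ subF-cong p A ⟩
    subF (λ i → var (there i)) A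
  ≡⟨ renF-as-subF there A ⟨
    wkF A
  ∎
  where
  open ≡-Reasoning
  p : (λ i → sub1 (var (there here)) (extR there (extR there i))) ≗ˢ (λ i → var (there i))
  p here      = refl
  p (there i) = refl

Negative-subF : ∀ {Γ Δ} {N : Formula Γ} (s : Sub Γ Δ) → Negative N → Negative (subF s N)
Negative-subF s (neq σ t u) = neq σ _ _
Negative-subF s ⊥ᶠ          = ⊥ᶠ
Negative-subF s (A ⇒ n)     = _ ⇒ Negative-subF s n
Negative-subF s (n ∧ m)     = Negative-subF s n ∧ Negative-subF s m
Negative-subF s (all σ n)   = all σ (Negative-subF (extS s) n)

-- Relativization adds Rel only in antecedents, and PA^ω formulas have no other positive atom.
PAω⇒Negative-ʳ : ∀ {Γ} {A : Formula Γ} → PAω A → Negative (A ʳ)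
PAω⇒Negative-ʳ (neq σ t u) = neq σ t u
PAω⇒Negative-ʳ ⊥ᶠ          = ⊥ᶠ
PAω⇒Negative-ʳ (a ⇒ b)     = _ ⇒ PAω⇒Negative-ʳ b
PAω⇒Negative-ʳ (a ∧ b)     = PAω⇒Negative-ʳ a ∧ PAω⇒Negative-ʳ b
PAω⇒Negative-ʳ (all σ a)   = all σ (_ ⇒ PAω⇒Negative-ʳ a)

⊢-cast : ∀ {Θ Γ Δ} {A A′ : Formula Θ} → A ≡ A′ → Γ ⊢ A ∣ Δ → Γ ⊢ A′ ∣ Δ
⊢-cast refl d = d

⊢-weakenʳ : ∀ {Θ Γ Δ Δ′} {A : Formula Θ} → Δ ⊆ Δ′ → Γ ⊢ A ∣ Δ → Γ ⊢ A ∣ Δ′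
⊢-weakenʳ Δ⊆Δ′ (ax A∈Γ)      = ax A∈Γ
⊢-weakenʳ Δ⊆Δ′ (⇒I d)        = ⇒I (⊢-weakenʳ Δ⊆Δ′ d)
⊢-weakenʳ Δ⊆Δ′ (⇒E d e)      = ⇒E (⊢-weakenʳ Δ⊆Δ′ d) (⊢-weakenʳ Δ⊆Δ′ e)
⊢-weakenʳ Δ⊆Δ′ (∧I d e)      = ∧I (⊢-weakenʳ Δ⊆Δ′ d) (⊢-weakenʳ Δ⊆Δ′ e)
⊢-weakenʳ Δ⊆Δ′ (∧E₁ d)       = ∧E₁ (⊢-weakenʳ Δ⊆Δ′ d)
⊢-weakenʳ Δ⊆Δ′ (∧E₂ d)       = ∧E₂ (⊢-weakenʳ Δ⊆Δ′ d)
⊢-weakenʳ Δ⊆Δ′ (∀I d)        = ∀I (⊢-weakenʳ (map⁺ wkF Δ⊆Δ′) d)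
⊢-weakenʳ Δ⊆Δ′ (∀E d t)      = ∀E (⊢-weakenʳ Δ⊆Δ′ d) t
⊢-weakenʳ Δ⊆Δ′ (save n N∈ d) = save n (Δ⊆Δ′ N∈) (⊢-weakenʳ Δ⊆Δ′ d)
⊢-weakenʳ Δ⊆Δ′ (restore n d) = restore n (⊢-weakenʳ (∷⁺ʳ _ Δ⊆Δ′) d)

-- There is no primitive ex falso; restore provides it for negative formulas.
⊥E-Negative : ∀ {Θ Γ Δ} {N : Formula Θ} → Negative N → Γ ⊢ ⊥ᶠ ∣ Δ → Γ ⊢ N ∣ Δ
⊥E-Negative n d = restore n (⊢-weakenʳ there d)

∀E-fresh : ∀ {Θ σ Γ Δ} (A : Formula (σ ∷ Θ)) → Γ ⊢ wkF (all σ A) ∣ Δ → Γ ⊢ A ∣ Δ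
∀E-fresh A d = ⊢-cast (wkF-all-[here] A) (∀E d (var here))

∀E-wkF² : ∀ {Θ σ τ Γ Δ} (A : Formula (σ ∷ Θ))
        → Γ ⊢ wkF {σ = τ} (wkF (all σ A)) ∣ Δ → Γ ⊢ wkF A ∣ Δ
∀E-wkF² A d = ⊢-cast (wkF²-all-[there-here] A) (∀E d (var (there here)))

-- Read B[x, y, z] as "z is a successor of y at stage x": seriality asks for a relevant
-- successor of every relevant (x, y), and a path is an h with h (S x) a successor of h x at
-- every relevant x. serialᴬ is seriality of A in the form "no successor ⇒ everything".

module _ (σ : Sort) {Θ : Ctx} (B : Formula (σ ∷ σ ∷ ι ∷ Θ)) where

  succᴬ succᴮ : Formula (σ ∷ σ ∷ ι ∷ Θ)
  succᴬ = instA (σ ∷ σ ∷ ι ∷ []) B v2 v1 v0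
  succᴮ = inst (σ ∷ σ ∷ ι ∷ []) (B ʳ) v2 v1 v0

  loopᴬ loopᴮ : Formula (ι ∷ σ ∷ ι ∷ Θ)
  loopᴬ = instA (ι ∷ σ ∷ ι ∷ []) B v0 v1 v1
  loopᴮ = inst (ι ∷ σ ∷ ι ∷ []) (B ʳ) v0 v1 v1

  pathᴬ pathᴮ : Formula (ι ∷ (ι ⟶ σ) ∷ Θ)
  pathᴬ = instA (ι ∷ (ι ⟶ σ) ∷ []) B v0 (app v1 v0) (app v1 (Suc v0))
  pathᴮ = inst (ι ∷ (ι ⟶ σ) ∷ []) (B ʳ) v0 (app v1 v0) (app v1 (Suc v0))

  serialᴬ serialᴮ pathlessᴬ pathlessᴮ : Formula Θ
  serialᴬ   = allʳ ι (allʳ σ (all σ (¬ᶠ succᴬ) ⇒ all ι loopᴬ))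
  serialᴮ   = allʳ ι (allʳ σ (exʳ σ succᴮ))
  pathlessᴬ = all (ι ⟶ σ) (¬ᶠ (allʳ ι pathᴬ))
  pathlessᴮ = allʳ (ι ⟶ σ) (¬ᶠ (allʳ ι pathᴮ))

  pathᴬ-fresh : ∀ {Γ Δ} → rel v0 ∷ wkF (allʳ ι pathᴬ) ∷ Γ ⊢ pathᴬ ∣ Δ
  pathᴬ-fresh = ⇒E (∀E-fresh (rel v0 ⇒ pathᴬ) (ax (there (here refl)))) (ax (here refl))

  pathlessᴬ-from-pathlessᴮ : ∀ {Γ Δ} → pathlessᴮ ∷ Γ ⊢ pathlessᴬ ∣ Δ
  pathlessᴬ-from-pathlessᴮ {Γ} {Δ} = ∀I (⇒I (⇒E (⇒E noPathᴮ h-relevant) h-pathᴮ))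
    where
    Γₕ : List (Formula ((ι ⟶ σ) ∷ Θ))
    Γₕ = allʳ ι pathᴬ ∷ wkF pathlessᴮ ∷ map wkF Γ

    noPathᴮ : Γₕ ⊢ RelS (ι ⟶ σ) v0 ⇒ ¬ᶠ (allʳ ι pathᴮ) ∣ map wkF Δ
    noPathᴮ = ∀E-fresh (RelS (ι ⟶ σ) v0 ⇒ ¬ᶠ (allʳ ι pathᴮ)) (ax (there (here refl)))

    h-relevant : Γₕ ⊢ RelS (ι ⟶ σ) v0 ∣ map wkF Δ
    h-relevant = ∀I (⇒I (∧E₁ (∧E₂ pathᴬ-fresh)))

    h-pathᴮ : Γₕ ⊢ allʳ ι pathᴮ ∣ map wkF Δ
    h-pathᴮ = ∀I (⇒I (∧E₂ (∧E₂ pathᴬ-fresh)))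

  no-successorᴬ-absurd : ∀ {Γ Δ}
    → all σ (¬ᶠ succᴬ) ∷ RelS σ v0 ∷ rel v1 ∷ wkF (wkF serialᴮ) ∷ Γ ⊢ ⊥ᶠ ∣ Δ
  no-successorᴬ-absurd {Γ} {Δ} = ⇒E successorᴮ noSuccessorᴮ
    where
    Γ₀ : List (Formula (σ ∷ ι ∷ Θ))
    Γ₀ = all σ (¬ᶠ succᴬ) ∷ RelS σ v0 ∷ rel v1 ∷ wkF (wkF serialᴮ) ∷ Γ

    successorᴮ : Γ₀ ⊢ exʳ σ succᴮ ∣ Δ
    successorᴮ =
      ⇒E (∀E-fresh (RelS σ v0 ⇒ exʳ σ succᴮ)
           (⇒E (∀E-wkF² (rel v0 ⇒ allʳ σ (exʳ σ succᴮ)) (ax (there (there (there (here refl))))))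
               (ax (there (there (here refl))))))
         (ax (there (here refl)))

    noSuccessorᴮ : Γ₀ ⊢ allʳ σ (¬ᶠ succᴮ) ∣ Δ
    noSuccessorᴮ =
      ∀I (⇒I (⇒I (⇒E (∀E-fresh (¬ᶠ succᴬ) (ax (there (there (here refl)))))
                     (∧I (ax (there (here refl)))
                         (∧I (⊢-cast wkF-RelS-here (ax (there (there (there (here refl))))))
                             (ax (here refl)))))))

  serialᴬ-from-serialᴮ : ∀ {Γ Δ} → Negative (B ʳ) → serialᴮ ∷ Γ ⊢ serialᴬ ∣ Δ
  serialᴬ-from-serialᴮ {Γ} {Δ} negBʳ =
    ∀I (⇒I (∀I (⇒I (⇒I (⇒E (⇒I (∀I loopᴬ-fresh))
                         (⊥E-Negative (all ι (Negative-subF _ negBʳ)) no-successorᴬ-absurd))))))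
    where
    Γ₁ : List (Formula (ι ∷ σ ∷ ι ∷ Θ))
    Γ₁ = map wkF (all ι loopᴮ ∷ all σ (¬ᶠ succᴬ) ∷ RelS σ v0 ∷ rel v1 ∷ wkF (wkF serialᴮ) ∷ map wkF (map wkF Γ))

    y-relevant : Γ₁ ⊢ RelS σ v1 ∣ map wkF (map wkF (map wkF Δ))
    y-relevant = ⊢-cast wkF-RelS-here (ax (there (there (here refl))))

    loopᴬ-fresh : Γ₁ ⊢ loopᴬ ∣ map wkF (map wkF (map wkF Δ))
    loopᴬ-fresh = ∧I y-relevant (∧I y-relevant (∀E-fresh loopᴮ (ax (here refl))))

mainTheorem13 : (σ : Sort) (Θ : Ctx) (B : Formula (σ ∷ σ ∷ ι ∷ Θ)) → PAω B
    → _⊢_∣_ {Θ} [] (Thm13 σ B) []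
mainTheorem13 σ Θ B pB =
  ⇒I (⇒I (⇒I (⇒E (⇒E (ax (there (there (here refl)))) serial) pathless)))
  where
  hypotheses : List (Formula Θ)
  hypotheses = pathlessᴮ σ B ∷ serialᴮ σ B ∷ (serialᴬ σ B ⇒ pathlessᴬ σ B ⇒ ⊥ᶠ) ∷ []

  serial : hypotheses ⊢ serialᴬ σ B ∣ []
  serial = ⇒E (⇒I (serialᴬ-from-serialᴮ σ B (PAω⇒Negative-ʳ pB))) (ax (there (here refl)))

  pathless : hypotheses ⊢ pathlessᴬ σ B ∣ []
  pathless = ⇒E (⇒I (pathlessᴬ-from-pathlessᴮ σ B)) (ax (here refl))
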